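{- Let $\mathcal D=(\mathcal P,\mathcal B)$ be a design with points $P_1,\dots,P_v$ and blocks $\mathfrak b_1,\dots,\mathfrak b_b$, let $A$ be the $b\times v$ integer matrix whose $(j,i)$ entry is $1$ if $P_i\in\mathfrak b_j$ and $0$ otherwise, and let $\mathfrak G_{\mathcal D}$ be its associated group (defined in the context). If the map $\mathcal P\to\mathfrak G_{\mathcal D}$, $X\mapsto X+\mathfrak R$, is not injective, then there exists a row vector $\mathbf v\in\mathbb Z^b$ such that $\mathbf vAA^{\mathsf T}\mathbf v^{\mathsf T}=2$.
   Context: Here a design is a finite set $\mathcal P$ of points together with a family $\mathcal B$ of subsets (blocks). Let $\mathfrak G$ be the free abelian group with basis $\mathcal P$, and let $\mathfrak R$ be the subgroup generated by the elements $\sum_{X\in\mathfrak b_j}X$, $j=1,\dots,b$ (equivalently the subgroup of $\mathbb Z^v$ generated by the rows of $A$). Define $\mathfrak G_{\mathcal D}=\mathfrak G/\mathfrak R$. -}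

module Defs where

open import Data.Nat using (ℕ; zero; suc)
open import Data.Fin using (Fin; zero; suc)
open import Data.Fin.Subset using (Subset; _∈_)
open import Data.Fin.Subset.Properties using (_∈?_)
open import Data.Integer using (ℤ; _+_; _-_; _*_; 0ℤ; 1ℤ)
open import Data.Product using (∃; _×_)
open import Relation.Binary.PropositionalEquality using (_≡_; _≢_)
open import Relation.Nullary using (does)
open import Data.Bool using (if_then_else_)

-- A design: v points P_1..P_v (indexed by Fin v) and b blocks
-- b_1..b_b (indexed by Fin b), each block a subset of the points.
-- (Repeated blocks are allowed, as in a family of subsets.)
record Design : Set where
  field
    v     : ℕ
    b     : ℕ
    block : Fin b → Subset v
open Design public

∑ : {n : ℕ} → (Fin n → ℤ) → ℤ
∑ {zero}  f = 0ℤ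
∑ {suc n} f = f zero + ∑ (λ i → f (suc i))

incidence : (D : Design) → Fin (b D) → Fin (v D) → ℤ
incidence D j i = if does (i ∈? block D j) then 1ℤ else 0ℤ

-- Elements of 𝔊 = free abelian group on 𝒫 ≅ ℤ^v.
𝔊 : Design → Set
𝔊 D = Fin (v D) → ℤ

point : (D : Design) → Fin (v D) → 𝔊 D
point D i k = if does (i Data.Fin.≟ k) then 1ℤ else 0ℤ

-- Membership in 𝔑, the subgroup generated by the rows of A:
-- x is an integer combination c A of the rows.
_∈𝔑_ : {D : Design} → 𝔊 D → Set
_∈𝔑_ {D} x = ∃ λ (c : Fin (b D) → ℤ) →
  ∀ i → ∑ (λ j → c j * incidence D j i) ≡ x i

-- Equality in the quotient 𝔊_D = 𝔊 / 𝔑.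
_≡[mod𝔑]_ : {D : Design} → 𝔊 D → 𝔊 D → Set
_≡[mod𝔑]_ {D} x y = _∈𝔑_ {D} (λ i → x i - y i)

NotInjective : Design → Set
NotInjective D = ∃ λ (X : Fin (v D)) → ∃ λ (Y : Fin (v D)) →
  X ≢ Y × _≡[mod𝔑]_ {D} (point D X) (point D Y)

AAᵀ : (D : Design) → Fin (b D) → Fin (b D) → ℤ
AAᵀ D j k = ∑ (λ i → incidence D j i * incidence D k i)

quadForm : (D : Design) → (Fin (b D) → ℤ) → ℤ
quadForm D w = ∑ (λ j → ∑ (λ k → w j * AAᵀ D j k * w k))

-- w A Aᵀ wᵀ = (w A)(w A)ᵀ is the squared length of the row vector w A.  If
-- X + 𝔑 = Y + 𝔑 for points X ≠ Y, some w ∈ ℤ^b has w A = X − Y, whose squared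
-- length is 1 + 1 = 2.
module Submission where

open import Defs
open import Data.Nat using (zero; suc)
open import Data.Fin using (Fin; zero; suc; _≟_)
open import Data.Integer using (ℤ; +_; _+_; _-_; _*_; 0ℤ; 1ℤ)
open import Data.Integer.Properties using (+-*-semiring; +-identityˡ; +-identityʳ)
open import Data.Integer.Solver using (module +-*-Solver)
open import Data.Product using (∃; _,_)
open import Data.Empty using (⊥-elim)
open import Data.Bool using (if_then_else_)
open import Function using (_∘_)
open import Relation.Binary.PropositionalEquality
  using (_≡_; _≢_; _≗_; refl; trans; cong; cong₂; module ≡-Reasoning)
open import Relation.Nullary using (does)
open import Algebra.Properties.Semiring.Sum +-*-semiring as Sum
  using (sum; sum-cong-≗; sum-replicate-zero; *-distribˡ-sum; *-distribʳ-sum)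
open ≡-Reasoning

∑≡sum : ∀ {n} (f : Fin n → ℤ) → ∑ f ≡ sum f
∑≡sum {zero}  f = refl
∑≡sum {suc n} f = cong (_+_ (f zero)) (∑≡sum (f ∘ suc))

∑-cong : ∀ {n} {f g : Fin n → ℤ} → f ≗ g → ∑ f ≡ ∑ g
∑-cong {f = f} {g} f≗g = begin
  ∑ f   ≡⟨ ∑≡sum f ⟩
  sum f ≡⟨ sum-cong-≗ f≗g ⟩
  sum g ≡⟨ ∑≡sum g ⟨
  ∑ g   ∎

∑-zero : ∀ n → ∑ {n} (λ _ → 0ℤ) ≡ 0ℤ
∑-zero n = trans (∑≡sum {n} (λ _ → 0ℤ)) (sum-replicate-zero n)

∑-comm : ∀ {m n} (f : Fin m → Fin n → ℤ) →
  ∑ (λ j → ∑ (f j)) ≡ ∑ (λ k → ∑ (λ j → f j k))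
∑-comm f = begin
  ∑ (λ j → ∑ (f j))                ≡⟨ ∑-cong (λ j → ∑≡sum (f j)) ⟩
  ∑ (λ j → sum (f j))              ≡⟨ ∑≡sum (λ j → sum (f j)) ⟩
  sum (λ j → sum (f j))            ≡⟨ Sum.∑-comm f ⟩
  sum (λ k → sum (λ j → f j k))    ≡⟨ ∑≡sum (λ k → sum (λ j → f j k)) ⟨
  ∑ (λ k → sum (λ j → f j k))      ≡⟨ ∑-cong (λ k → ∑≡sum (λ j → f j k)) ⟨
  ∑ (λ k → ∑ (λ j → f j k))        ∎

*-distribˡ-∑ : ∀ {n} x (f : Fin n → ℤ) → x * ∑ f ≡ ∑ (λ i → x * f i)
*-distribˡ-∑ x f = begin
  x * ∑ f                ≡⟨ cong (x *_) (∑≡sum f) ⟩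
  x * sum f              ≡⟨ *-distribˡ-sum x f ⟩
  sum (λ i → x * f i)    ≡⟨ ∑≡sum (λ i → x * f i) ⟨
  ∑ (λ i → x * f i)      ∎

*-distribʳ-∑ : ∀ {n} x (f : Fin n → ℤ) → ∑ f * x ≡ ∑ (λ i → f i * x)
*-distribʳ-∑ x f = begin
  ∑ f * x                ≡⟨ cong (_* x) (∑≡sum f) ⟩
  sum f * x              ≡⟨ *-distribʳ-sum x f ⟩
  sum (λ i → f i * x)    ≡⟨ ∑≡sum (λ i → f i * x) ⟨
  ∑ (λ i → f i * x)      ∎

infixl 7 _⋆_

_⋆_ : ∀ {m n} → (Fin m → ℤ) → (Fin m → Fin n → ℤ) → Fin n → ℤ
(w ⋆ M) i = ∑ (λ j → w j * M j i)

‖_‖² : ∀ {n} → (Fin n → ℤ) → ℤ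
‖ u ‖² = ∑ (λ i → u i * u i)

∑∑-Gram≡‖⋆‖² : ∀ {m n} (M : Fin m → Fin n → ℤ) (w : Fin m → ℤ) →
  ∑ (λ j → ∑ (λ k → w j * ∑ (λ i → M j i * M k i) * w k)) ≡ ‖ w ⋆ M ‖²
∑∑-Gram≡‖⋆‖² M w = begin
  ∑ (λ j → ∑ (λ k → w j * ∑ (λ i → M j i * M k i) * w k))
    ≡⟨ ∑-cong (λ j → ∑-cong (λ k → entry j k)) ⟩
  ∑ (λ j → ∑ (λ k → ∑ (λ i → wM j i * wM k i)))
    ≡⟨ ∑-cong (λ j → ∑-comm (λ k i → wM j i * wM k i)) ⟩
  ∑ (λ j → ∑ (λ i → ∑ (λ k → wM j i * wM k i)))
    ≡⟨ ∑-comm (λ j i → ∑ (λ k → wM j i * wM k i)) ⟩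
  ∑ (λ i → ∑ (λ j → ∑ (λ k → wM j i * wM k i)))
    ≡⟨ ∑-cong (λ i → ∑-cong (λ j → *-distribˡ-∑ (wM j i) (λ k → wM k i))) ⟨
  ∑ (λ i → ∑ (λ j → wM j i * (w ⋆ M) i))
    ≡⟨ ∑-cong (λ i → *-distribʳ-∑ ((w ⋆ M) i) (λ j → wM j i)) ⟨
  ‖ w ⋆ M ‖²
    ∎
  where
  wM : _ → _ → ℤ
  wM j i = w j * M j i

  entry : ∀ j k → w j * ∑ (λ i → M j i * M k i) * w k ≡ ∑ (λ i → wM j i * wM k i)
  entry j k = begin
    w j * ∑ (λ i → M j i * M k i) * w k
      ≡⟨ cong (_* w k) (*-distribˡ-∑ (w j) (λ i → M j i * M k i)) ⟩
    ∑ (λ i → w j * (M j i * M k i)) * w k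
      ≡⟨ *-distribʳ-∑ (w k) (λ i → w j * (M j i * M k i)) ⟩
    ∑ (λ i → w j * (M j i * M k i) * w k)
      ≡⟨ ∑-cong (λ i → rearrange (w j) (M j i) (M k i) (w k)) ⟩
    ∑ (λ i → wM j i * wM k i)
      ∎
    where
    open +-*-Solver
    rearrange : ∀ a x y c → a * (x * y) * c ≡ a * x * (c * y)
    rearrange = solve 4 (λ a x y c → a :* (x :* y) :* c := a :* x :* (c :* y)) refl

quadForm≡‖⋆incidence‖² : (D : Design) (w : Fin (b D) → ℤ) →
  quadForm D w ≡ ‖ w ⋆ incidence D ‖²
quadForm≡‖⋆incidence‖² D = ∑∑-Gram≡‖⋆‖² (incidence D)

-- `point D` unfolds to `δ`, so membership in 𝔑 is directly an equation on δ.
δ : ∀ {n} → Fin n → Fin n → ℤ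
δ i k = if does (i ≟ k) then 1ℤ else 0ℤ

∑-∘δ : ∀ {n} (f : ℤ → ℤ) → f 0ℤ ≡ 0ℤ → (y : Fin n) → ∑ (f ∘ δ y) ≡ f 1ℤ
∑-∘δ {suc n} f f0≡0 zero = begin
  f 1ℤ + ∑ {n} (λ _ → f 0ℤ)  ≡⟨ cong (_+_ (f 1ℤ)) (∑-cong {n} (λ _ → f0≡0)) ⟩
  f 1ℤ + ∑ {n} (λ _ → 0ℤ)     ≡⟨ cong (_+_ (f 1ℤ)) (∑-zero n) ⟩
  f 1ℤ + 0ℤ                   ≡⟨ +-identityʳ (f 1ℤ) ⟩
  f 1ℤ                        ∎
∑-∘δ {suc n} f f0≡0 (suc y) = begin
  f 0ℤ + ∑ (f ∘ δ y)     ≡⟨ cong₂ _+_ f0≡0 (∑-∘δ f f0≡0 y) ⟩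
  0ℤ + f 1ℤ              ≡⟨ +-identityˡ (f 1ℤ) ⟩
  f 1ℤ                   ∎

‖δ-δ‖²≡2 : ∀ {n} {x y : Fin n} → x ≢ y → ‖ (λ k → δ x k - δ y k) ‖² ≡ + 2
‖δ-δ‖²≡2 {x = zero}  {zero}  x≢y = ⊥-elim (x≢y refl)
‖δ-δ‖²≡2 {x = zero}  {suc y} _   = cong (_+_ 1ℤ) (∑-∘δ (λ d → (0ℤ - d) * (0ℤ - d)) refl y)
‖δ-δ‖²≡2 {x = suc x} {zero}  _   = cong (_+_ 1ℤ) (∑-∘δ (λ d → (d - 0ℤ) * (d - 0ℤ)) refl x)
‖δ-δ‖²≡2 {x = suc x} {suc y} x≢y = trans (+-identityˡ _) (‖δ-δ‖²≡2 (x≢y ∘ cong suc))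

corollary5 : (D : Design) → NotInjective D →
    ∃ λ (w : Fin (b D) → ℤ) → quadForm D w ≡ + 2
corollary5 D (X , Y , X≢Y , w , wA≡X-Y) = w , (begin
  quadForm D w                        ≡⟨ quadForm≡‖⋆incidence‖² D w ⟩
  ‖ w ⋆ incidence D ‖²                ≡⟨ ∑-cong (λ i → cong₂ _*_ (wA≡X-Y i) (wA≡X-Y i)) ⟩
  ‖ (λ k → δ X k - δ Y k) ‖²          ≡⟨ ‖δ-δ‖²≡2 X≢Y ⟩
  + 2                                 ∎)
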